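{- Let $T_n$ be a transitive tournament with $n$ vertices, where $n \geq 3$. Then $\Delta(T_n) = \left\lceil \frac{n+1}{2} \right\rceil$.
   Context: A tournament $T$ is a finite vertex set $V(T)$ with an arc set $A(T)$ such that for all distinct $x,y$, exactly one of $(x,y),(y,x)$ lies in $A(T)$; it is transitive if $(x,y),(y,z)\in A(T)$ imply $(x,z)\in A(T)$. A module of $T$ is a subset $M \subseteq V(T)$ such that for all $x,y \in M$ and $v \notin M$, $(v,x)\in A(T)$ iff $(v,y)\in A(T)$; the trivial modules are $\emptyset$, singletons and $V(T)$. For $X \subseteq V(T)$ write $\overline{X} = V(T)\setminus X$. A co-module of $T$ is a subset $M \subseteq V(T)$ such that $M$ or $\overline{M}$ is a nontrivial module of $T$. A co-modular decomposition of $T$ is a set of pairwise disjoint co-modules of $T$. The co-modular index $\Delta(T)$ is the largest size of a co-modular decomposition of $T$. -}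

module Defs where

open import Data.Nat using (ℕ)
open import Data.Bool using (Bool; true; false; not)
open import Data.Fin using (Fin)
open import Data.Fin.Subset using (Subset; _∈_; _∉_; ⊥; ⊤; ⁅_⁆; ∁; _∩_)
open import Data.List using (List; length)
open import Data.List.Relation.Unary.All using (All)
open import Data.List.Relation.Unary.AllPairs using (AllPairs)
open import Data.Product using (Σ; ∃; _×_)
open import Data.Sum using (_⊎_)
open import Relation.Nullary using (¬_)
open import Relation.Binary.PropositionalEquality using (_≡_; _≢_)

record Tournament (n : ℕ) : Set where
  field
    arc     : Fin n → Fin n → Bool
    irrefl  : ∀ x → arc x x ≡ false
    exactly : ∀ x y → x ≢ y → arc x y ≡ not (arc y x)
open Tournament public

IsTransitive : ∀ {n} → Tournament n → Set
IsTransitive T = ∀ x y z → arc T x y ≡ true → arc T y z ≡ true → arc T x z ≡ true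

IsModule : ∀ {n} → Tournament n → Subset n → Set
IsModule T M = ∀ x y v → x ∈ M → y ∈ M → v ∉ M → arc T v x ≡ arc T v y

IsTrivial : ∀ {n} → Subset n → Set
IsTrivial {n} M = (M ≡ ⊥) ⊎ (∃ λ (x : Fin n) → M ≡ ⁅ x ⁆) ⊎ (M ≡ ⊤)

IsNontrivialModule : ∀ {n} → Tournament n → Subset n → Set
IsNontrivialModule T M = IsModule T M × ¬ IsTrivial M

IsCoModule : ∀ {n} → Tournament n → Subset n → Set
IsCoModule T M = IsNontrivialModule T M ⊎ IsNontrivialModule T (∁ M)

Disjoint : ∀ {n} → Subset n → Subset n → Set
Disjoint A B = A ∩ B ≡ ⊥

-- A co-modular decomposition, given as a list of pairwise disjoint co-modules.
-- (Co-modules are nonempty, so pairwise disjointness forces the entries to be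
-- distinct; hence the length of the list is the size of the set.)
IsCoModularDecomposition : ∀ {n} → Tournament n → List (Subset n) → Set
IsCoModularDecomposition T D = All (IsCoModule T) D × AllPairs Disjoint D

CoModularIndexIs : ∀ {n} → Tournament n → ℕ → Set
CoModularIndexIs T k =
  (Σ (List _) λ D → IsCoModularDecomposition T D × length D ≡ k) ×
  (∀ D → IsCoModularDecomposition T D → length D Data.Nat.≤ k)

-- A co-module M either has at
-- least two vertices, or ∁ M is a nontrivial module; in the latter case any
-- v ∈ M sees the whole of ∁ M in the same way, so v beats every vertex
-- outside M or loses to every vertex outside M ("M is anchored").  Two
-- disjoint sets cannot be anchored in the same direction (their anchors
-- would beat each other), so a co-modular decomposition D contains at most
-- two anchored members, each of size ≥ 1, while all other members have size
-- ≥ 2.  As the members are disjoint, 2·|D| ≤ n + 2.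
--
-- In a transitive tournament the in-degree ("rank") is a
-- bijection onto {0,…,n-1} and u → v iff rank u < rank v, so every interval
-- of ranks is a module.  The complements of the ranks [1,n-1] and [0,n-2]
-- (the source and the sink) together with the pairs of ranks {2j+1, 2j+2}
-- form a decomposition of the required size.
module Submission where

open import Defs
open import Data.Nat using (ℕ; _≥_; ⌈_/2⌉; suc)
open import Data.Nat using (zero; _+_; _≤_; _<_; z≤n; s≤s; _≤?_; ⌊_/2⌋)
open import Data.Nat.Properties
  using ( ≤-refl; ≤-reflexive; ≤-trans; <-trans; <-≤-trans; ≤-<-trans; <-irrefl; <-asym
        ; <⇒≤; <⇒≢; ≰⇒>; ≤∧≢⇒<; n≤1+n; n<1+n; m≤n⇒m≤1+n; <⇒≤pred; suc-injective
        ; +-suc; +-assoc; +-comm; +-mono-≤; +-monoʳ-≤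
        ; n≡⌊n+n/2⌋; ⌊n/2⌋-mono; ⌊n/2⌋≤⌈n/2⌉; ⌊n/2⌋+⌈n/2⌉≡n; module ≤-Reasoning )
open import Data.Bool using (Bool; true; false; not)
open import Data.Bool.Properties using (not-¬; ¬-not; not-injective)
import Data.Bool.Properties as Bool
open import Data.Fin using (Fin; toℕ; fromℕ<; punchOut)
import Data.Fin.Properties as Fin
open import Data.Fin.Subset
open import Data.Fin.Subset.Properties
open import Data.Vec using ([]; _∷_; tabulate)
open import Data.Vec.Properties using (lookup∘tabulate; []=⇒lookup; lookup⇒[]=; ∷-injectiveʳ)
open import Data.List using (List; []; _∷_; length; map; applyUpTo)
open import Data.Nat.ListAction using (sum)
open import Data.List.Properties using (length-applyUpTo)
open import Data.List.Relation.Unary.All as All using (All; []; _∷_)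
import Data.List.Relation.Unary.All.Properties as All
open import Data.List.Relation.Unary.AllPairs using (AllPairs; []; _∷_)
import Data.List.Relation.Unary.AllPairs.Properties as AllPairs
open import Data.Product using (∃; _×_; _,_; proj₁; proj₂)
open import Data.Sum using (_⊎_; inj₁; inj₂)
open import Function using (_∘_)
open import Function.Definitions using (Injective)
open import Relation.Nullary using (¬_; Dec; yes; no; does; contradiction)
open import Relation.Nullary.Decidable using (dec-true; _×-dec_)
open import Relation.Binary.PropositionalEquality
import Algebra.Lattice.Properties.BooleanAlgebra as BooleanAlgebra

⟦_⟧ : ∀ {n} {P : Fin n → Set} → (∀ x → Dec (P x)) → Subset n
⟦ P? ⟧ = tabulate (λ x → does (P? x))

∈⟦⟧⁺ : ∀ {n} {P : Fin n → Set} (P? : ∀ x → Dec (P x)) {x} → P x → x ∈ ⟦ P? ⟧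
∈⟦⟧⁺ P? {x} px = lookup⇒[]= x _ (trans (lookup∘tabulate (λ y → does (P? y)) x) (dec-true (P? x) px))

∈⟦⟧⁻ : ∀ {n} {P : Fin n → Set} (P? : ∀ x → Dec (P x)) {x} → x ∈ ⟦ P? ⟧ → P x
∈⟦⟧⁻ P? {x} x∈ with P? x | trans (sym (lookup∘tabulate (λ y → does (P? y)) x)) ([]=⇒lookup x∈)
... | yes px | _  = px
... | no _   | ()

∁-involutive : ∀ {n} (p : Subset n) → ∁ (∁ p) ≡ p
∁-involutive {n} = BooleanAlgebra.¬-involutive (∪-∩-booleanAlgebra n)

∁⊥≡⊤ : ∀ {n} → ∁ (⊥ {n}) ≡ ⊤
∁⊥≡⊤ {n} = BooleanAlgebra.¬⊥≈⊤ (∪-∩-booleanAlgebra n)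

∣p∣≡0⇒p≡⊥ : ∀ {n} (p : Subset n) → ∣ p ∣ ≡ 0 → p ≡ ⊥
∣p∣≡0⇒p≡⊥ []           _  = refl
∣p∣≡0⇒p≡⊥ (true ∷ p)   ()
∣p∣≡0⇒p≡⊥ (false ∷ p)  eq = cong (false ∷_) (∣p∣≡0⇒p≡⊥ p eq)

∣p∣≡1⇒singleton : ∀ {n} (p : Subset n) → ∣ p ∣ ≡ 1 → ∃ λ x → p ≡ ⁅ x ⁆
∣p∣≡1⇒singleton (true ∷ p)  eq = Data.Fin.zero , cong (true ∷_) (∣p∣≡0⇒p≡⊥ p (suc-injective eq))
∣p∣≡1⇒singleton (false ∷ p) eq with ∣p∣≡1⇒singleton p eq
... | x , p≡⁅x⁆ = Data.Fin.suc x , cong (false ∷_) p≡⁅x⁆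

nontrivial⇒2≤∣p∣ : ∀ {n} {p : Subset n} → ¬ IsTrivial p → 2 ≤ ∣ p ∣
nontrivial⇒2≤∣p∣ {p = p} nontrivial with ∣ p ∣ in eq
... | zero          = contradiction (inj₁ (∣p∣≡0⇒p≡⊥ p eq)) nontrivial
... | suc zero      = contradiction (inj₂ (inj₁ (∣p∣≡1⇒singleton p eq))) nontrivial
... | suc (suc _)   = s≤s (s≤s z≤n)

nontrivial⇒nonempty : ∀ {n} {p : Subset n} → ¬ IsTrivial p → Nonempty p
nontrivial⇒nonempty {p = p} nontrivial with nonempty? p
... | yes ne = ne
... | no ¬ne = contradiction (inj₁ (Empty-unique ¬ne)) nontrivial

nontrivial⇒∁nonempty : ∀ {n} {p : Subset n} → ¬ IsTrivial p → Nonempty (∁ p)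
nontrivial⇒∁nonempty {p = p} nontrivial with nonempty? (∁ p)
... | yes ne = ne
... | no ¬ne = contradiction (inj₂ (inj₂ p≡⊤)) nontrivial
  where
  p≡⊤ : p ≡ ⊤
  p≡⊤ = trans (sym (∁-involutive p)) (trans (cong ∁ (Empty-unique ¬ne)) ∁⊥≡⊤)

two-in-one-out⇒nontrivial : ∀ {n} {p : Subset n} {u w o} →
  u ∈ p → w ∈ p → u ≢ w → o ∉ p → ¬ IsTrivial p
two-in-one-out⇒nontrivial {p = p} {u} {w} {o} u∈p w∈p u≢w o∉p = refute
  where
  refute : ¬ IsTrivial p
  refute (inj₁ p≡⊥)            = ∉⊥ (subst (u ∈_) p≡⊥ u∈p)
  refute (inj₂ (inj₁ (x , p≡⁅x⁆))) =
    u≢w (trans (x∈⁅y⁆⇒x≡y x (subst (u ∈_) p≡⁅x⁆ u∈p)) (sym (x∈⁅y⁆⇒x≡y x (subst (w ∈_) p≡⁅x⁆ w∈p))))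
  refute (inj₂ (inj₂ p≡⊤))     = o∉p (subst (o ∈_) (sym p≡⊤) ∈⊤)

disjoint⁻ : ∀ {n} {p q : Subset n} {x} → Disjoint p q → x ∈ p → x ∉ q
disjoint⁻ p∩q≡⊥ x∈p x∈q = ∉⊥ (subst (_ ∈_) p∩q≡⊥ (x∈p∩q⁺ (x∈p , x∈q)))

disjoint⁺ : ∀ {n} {p q : Subset n} → (∀ {x} → x ∈ p → x ∉ q) → Disjoint p q
disjoint⁺ {p = p} {q} separated =
  Empty-unique λ (x , x∈p∩q) → let (x∈p , x∈q) = x∈p∩q⁻ p q x∈p∩q in separated x∈p x∈q

∁-disjoint : ∀ {n} {p q : Subset n} → q ⊆ p → Disjoint (∁ p) q
∁-disjoint q⊆p = disjoint⁺ λ x∈∁p x∈q → x∈∁p⇒x∉p x∈∁p (q⊆p x∈q)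

disjoint-⋃ : ∀ {n} {p : Subset n} {D} → All (Disjoint p) D → Disjoint p (⋃ D)
disjoint-⋃ {p = p} []                = ∩-zeroʳ p
disjoint-⋃ {p = p} {q ∷ D} (p∩q≡⊥ ∷ rest) = begin
  p ∩ (q ∪ ⋃ D)       ≡⟨ ∩-distribˡ-∪ p q (⋃ D) ⟩
  p ∩ q ∪ p ∩ ⋃ D     ≡⟨ cong₂ _∪_ p∩q≡⊥ (disjoint-⋃ rest) ⟩
  ⊥ ∪ ⊥               ≡⟨ ∪-identityˡ ⊥ ⟩
  ⊥                   ∎
  where open ≡-Reasoning

∣p∪q∣≡∣p∣+∣q∣ : ∀ {n} (p q : Subset n) → Disjoint p q → ∣ p ∪ q ∣ ≡ ∣ p ∣ + ∣ q ∣
∣p∪q∣≡∣p∣+∣q∣ []          []          _  = refl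
∣p∪q∣≡∣p∣+∣q∣ (true ∷ p)  (true ∷ q)  ()
∣p∪q∣≡∣p∣+∣q∣ (true ∷ p)  (false ∷ q) eq = cong suc (∣p∪q∣≡∣p∣+∣q∣ p q (∷-injectiveʳ eq))
∣p∪q∣≡∣p∣+∣q∣ (false ∷ p) (true ∷ q)  eq =
  trans (cong suc (∣p∪q∣≡∣p∣+∣q∣ p q (∷-injectiveʳ eq))) (sym (+-suc ∣ p ∣ ∣ q ∣))
∣p∪q∣≡∣p∣+∣q∣ (false ∷ p) (false ∷ q) eq = ∣p∪q∣≡∣p∣+∣q∣ p q (∷-injectiveʳ eq)

sum-sizes≤n : ∀ {n} {D : List (Subset n)} → AllPairs Disjoint D → sum (map ∣_∣ D) ≤ n
sum-sizes≤n {n} {D} disjoint = ≤-trans (≤-reflexive (sum≡∣⋃∣ disjoint)) (∣p∣≤n (⋃ D))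
  where
  sum≡∣⋃∣ : ∀ {D : List (Subset n)} → AllPairs Disjoint D → sum (map ∣_∣ D) ≡ ∣ ⋃ D ∣
  sum≡∣⋃∣ []                        = sym (∣⊥∣≡0 n)
  sum≡∣⋃∣ {p ∷ D} (p-disj ∷ disj) =
    trans (cong (∣ p ∣ +_) (sum≡∣⋃∣ disj)) (sym (∣p∪q∣≡∣p∣+∣q∣ p (⋃ D) (disjoint-⋃ p-disj)))

distinct-booleans≤2 : ∀ {bs : List Bool} → AllPairs _≢_ bs → length bs ≤ 2
distinct-booleans≤2 []                 = z≤n
distinct-booleans≤2 (_ ∷ [])           = s≤s z≤n
distinct-booleans≤2 (_ ∷ _ ∷ [])       = s≤s (s≤s z≤n)
distinct-booleans≤2 ((x≢y ∷ x≢z ∷ _) ∷ (y≢z ∷ _) ∷ _) =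
  contradiction (not-injective (trans (sym (¬-not x≢y)) (¬-not x≢z))) y≢z

module UpperBound {n : ℕ} (T : Tournament n) where

  Anchored : Bool → Subset n → Set
  Anchored b M = ∃ λ v → v ∈ M × (∀ z → z ∉ M → arc T v z ≡ b)

  data Shape (M : Subset n) : Set where
    large    : 2 ≤ ∣ M ∣ → Shape M
    anchored : ∀ b → Anchored b M → Shape M

  -- A co-module either has two vertices, or its complement is a module, and
  -- then any of its vertices sees the (nonempty) complement uniformly.
  shape : ∀ {M} → IsCoModule T M → Shape M
  shape (inj₁ (_ , nontrivial)) = large (nontrivial⇒2≤∣p∣ nontrivial)
  shape {M} (inj₂ (module∁M , nontrivial))
    with nontrivial⇒∁nonempty nontrivial | nontrivial⇒nonempty nontrivial
  ... | v , v∈∁∁M | a , a∈∁M = anchored (arc T v a) (v , v∈M , sees-uniformly)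
    where
    v∈M : v ∈ M
    v∈M = subst (v ∈_) (∁-involutive M) v∈∁∁M
    sees-uniformly : ∀ z → z ∉ M → arc T v z ≡ arc T v a
    sees-uniformly z z∉M = module∁M z a v (x∉p⇒x∈∁p z∉M) a∈∁M (x∈p⇒x∉∁p v∈M)

  -- Anchors of disjoint sets point in opposite directions: they play each other.
  anchors-differ : ∀ {M N b c} → Disjoint M N → Anchored b M → Anchored c N → b ≢ c
  anchors-differ {b = b} M∩N≡⊥ (v , v∈M , v-sees) (w , w∈N , w-sees) refl =
    not-¬ refl (begin
      arc T w v        ≡⟨ w-sees v (disjoint⁻ M∩N≡⊥ v∈M) ⟩
      b                ≡⟨ v-sees w (λ w∈M → disjoint⁻ M∩N≡⊥ w∈M w∈N) ⟨
      arc T v w        ≡⟨ exactly T v w v≢w ⟩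
      not (arc T w v)  ∎)
    where
    open ≡-Reasoning
    v≢w : v ≢ w
    v≢w refl = disjoint⁻ M∩N≡⊥ v∈M w∈N

  directions : ∀ {D} → All Shape D → List Bool
  directions []                    = []
  directions (large _ ∷ shapes)      = directions shapes
  directions (anchored b _ ∷ shapes) = b ∷ directions shapes

  directions-distinct : ∀ {D} → AllPairs Disjoint D → (shapes : All Shape D) →
    AllPairs _≢_ (directions shapes)
  directions-distinct []              []                      = []
  directions-distinct (_ ∷ disj)      (large _ ∷ shapes)      = directions-distinct disj shapes
  directions-distinct {M ∷ _} (M-disj ∷ disj) (anchored b aM ∷ shapes) =
    differ M-disj shapes ∷ directions-distinct disj shapes
    where
    differ : ∀ {D} → All (Disjoint M) D → (shapes : All Shape D) → All (b ≢_) (directions shapes)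
    differ []             []                       = []
    differ (_ ∷ ds)       (large _ ∷ shapes)       = differ ds shapes
    differ (M∩N≡⊥ ∷ ds)   (anchored c aN ∷ shapes) = anchors-differ M∩N≡⊥ aM aN ∷ differ ds shapes

  -- Each member contributes 2 to the left-hand side: a large member through its
  -- size, an anchored one through its (nonzero) size plus its direction.
  double-length : ∀ {D} (shapes : All Shape D) →
    length D + length D ≤ sum (map ∣_∣ D) + length (directions shapes)
  double-length [] = z≤n
  double-length {M ∷ D} (large 2≤∣M∣ ∷ shapes) = begin
    suc (length D) + suc (length D)          ≡⟨ +-suc (suc (length D)) (length D) ⟩
    2 + (length D + length D)                ≤⟨ +-mono-≤ 2≤∣M∣ (double-length shapes) ⟩
    ∣ M ∣ + (sum (map ∣_∣ D) + length ds)    ≡⟨ +-assoc ∣ M ∣ _ _ ⟨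
    ∣ M ∣ + sum (map ∣_∣ D) + length ds      ∎
    where
    open ≤-Reasoning
    ds = directions shapes
  double-length {M ∷ D} (anchored b (v , v∈M , _) ∷ shapes) = begin
    suc (length D) + suc (length D)          ≡⟨ +-suc (suc (length D)) (length D) ⟩
    1 + suc (length D + length D)            ≤⟨ +-mono-≤ 1≤∣M∣ (s≤s (double-length shapes)) ⟩
    ∣ M ∣ + suc (sum (map ∣_∣ D) + length ds) ≡⟨ cong (∣ M ∣ +_) (+-suc _ (length ds)) ⟨
    ∣ M ∣ + (sum (map ∣_∣ D) + suc (length ds)) ≡⟨ +-assoc ∣ M ∣ _ _ ⟨
    ∣ M ∣ + sum (map ∣_∣ D) + suc (length ds) ∎
    where
    open ≤-Reasoning
    ds = directions shapes
    1≤∣M∣ : 1 ≤ ∣ M ∣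
    1≤∣M∣ = ≤-trans (≤-reflexive (sym (∣⁅x⁆∣≡1 v)))
                     (p⊆q⇒∣p∣≤∣q∣ λ {x} x∈⁅v⁆ → subst (_∈ M) (sym (x∈⁅y⁆⇒x≡y v x∈⁅v⁆)) v∈M)

  upper-bound : ∀ D → IsCoModularDecomposition T D → length D ≤ ⌈ suc n /2⌉
  upper-bound D (coModules , disjoint) = begin
    length D                     ≡⟨ n≡⌊n+n/2⌋ (length D) ⟩
    ⌊ length D + length D /2⌋    ≤⟨ ⌊n/2⌋-mono 2∣D∣≤n+2 ⟩
    ⌊ n + 2 /2⌋                  ≡⟨ cong ⌊_/2⌋ (+-comm n 2) ⟩
    ⌈ suc n /2⌉                  ∎
    where
    open ≤-Reasoning
    shapes = All.map shape coModules
    2∣D∣≤n+2 : length D + length D ≤ n + 2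
    2∣D∣≤n+2 = ≤-trans (double-length shapes)
      (+-mono-≤ (sum-sizes≤n disjoint) (distinct-booleans≤2 (directions-distinct disjoint shapes)))

injective⇒surjective : ∀ {n} (f : Fin n → Fin n) → Injective _≡_ _≡_ f → ∀ k → ∃ λ x → f x ≡ k
injective⇒surjective {suc n} f f-injective k with Fin.any? (λ x → f x Fin.≟ k)
... | yes hit = hit
... | no miss = contradiction (Fin.injective⇒≤ g-injective) (<-irrefl refl)
  where
  -- f misses k, so f squeezes Fin (suc n) injectively into Fin n.
  k≢f : ∀ x → k ≢ f x
  k≢f x k≡fx = miss (x , sym k≡fx)
  g : Fin (suc n) → Fin n
  g x = punchOut (k≢f x)
  g-injective : Injective _≡_ _≡_ g
  g-injective gx≡gy = f-injective (Fin.punchOut-injective (k≢f _) (k≢f _) gx≡gy)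

module Ranks {n : ℕ} (T : Tournament n) (transitive : IsTransitive T) where

  arc-into? : ∀ x y → Dec (arc T y x ≡ true)
  arc-into? x y = arc T y x Bool.≟ true

  in-neighbours : Fin n → Subset n
  in-neighbours x = ⟦ arc-into? x ⟧

  rank : Fin n → ℕ
  rank x = ∣ in-neighbours x ∣

  x∉in-neighbours : ∀ x → x ∉ in-neighbours x
  x∉in-neighbours x x∈ with () ← trans (sym (irrefl T x)) (∈⟦⟧⁻ (arc-into? x) x∈)

  -- By transitivity an arc x → y makes the in-neighbourhood of x a proper
  -- subset of that of y.
  arc⇒rank< : ∀ {x y} → arc T x y ≡ true → rank x < rank y
  arc⇒rank< {x} {y} x→y = p⊂q⇒∣p∣<∣q∣
    ( (λ z∈ → ∈⟦⟧⁺ (arc-into? y) (transitive _ x y (∈⟦⟧⁻ (arc-into? x) z∈) x→y))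
    , x , ∈⟦⟧⁺ (arc-into? y) x→y , x∉in-neighbours x )

  ¬arc⇒rank> : ∀ {x y} → x ≢ y → arc T x y ≡ false → rank y < rank x
  ¬arc⇒rank> {x} {y} x≢y x↛y = arc⇒rank< (trans (exactly T y x (x≢y ∘ sym)) (cong not x↛y))

  rank<⇒arc : ∀ {v x} → rank v < rank x → arc T v x ≡ true
  rank<⇒arc {v} {x} v<x with arc T v x in v?x
  ... | true  = refl
  ... | false = contradiction (¬arc⇒rank> v≢x v?x) (<-asym v<x)
    where
    v≢x : v ≢ x
    v≢x refl = <-irrefl refl v<x

  rank>⇒¬arc : ∀ {v x} → rank x < rank v → arc T v x ≡ false
  rank>⇒¬arc {v} {x} x<v with arc T v x in v?x
  ... | false = refl
  ... | true  = contradiction (arc⇒rank< v?x) (<-asym x<v)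

  rank-injective : ∀ {x y} → rank x ≡ rank y → x ≡ y
  rank-injective {x} {y} rx≡ry with x Fin.≟ y | arc T x y in x?y
  ... | yes x≡y | _     = x≡y
  ... | no x≢y  | true  = contradiction rx≡ry (<⇒≢ (arc⇒rank< x?y))
  ... | no x≢y  | false = contradiction (sym rx≡ry) (<⇒≢ (¬arc⇒rank> x≢y x?y))

  rank<n : ∀ x → rank x < n
  rank<n x = ≤∧≢⇒< (∣p∣≤n (in-neighbours x)) λ rx≡n →
    x∉in-neighbours x (subst (x ∈_) (sym (∣p∣≡n⇒p≡⊤ rx≡n)) ∈⊤)

  -- Ranks are injective with values below n, hence every k < n is a rank.
  rank-surjective : ∀ {k} → k < n → ∃ λ x → rank x ≡ k
  rank-surjective {k} k<n with injective⇒surjective rank′ rank′-injective (fromℕ< k<n)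
    where
    rank′ : Fin n → Fin n
    rank′ x = fromℕ< (rank<n x)
    rank′-injective : Injective _≡_ _≡_ rank′
    rank′-injective {x} {y} eq = rank-injective (begin
      rank x                  ≡⟨ Fin.toℕ-fromℕ< (rank<n x) ⟨
      toℕ (fromℕ< (rank<n x)) ≡⟨ cong toℕ eq ⟩
      toℕ (fromℕ< (rank<n y)) ≡⟨ Fin.toℕ-fromℕ< (rank<n y) ⟩
      rank y                  ∎)
      where open ≡-Reasoning
  ... | x , eq = x , trans (sym (Fin.toℕ-fromℕ< (rank<n x))) (trans (cong toℕ eq) (Fin.toℕ-fromℕ< k<n))

  InInterval : ℕ → ℕ → Fin n → Set
  InInterval a b x = a ≤ rank x × rank x ≤ b

  interval : ℕ → ℕ → Subset n
  interval a b = ⟦ (λ x → a ≤? rank x ×-dec rank x ≤? b) ⟧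

  ∈interval⁺ : ∀ {a b x} → InInterval a b x → x ∈ interval a b
  ∈interval⁺ {a} {b} = ∈⟦⟧⁺ (λ x → a ≤? rank x ×-dec rank x ≤? b)

  ∈interval⁻ : ∀ {a b x} → x ∈ interval a b → InInterval a b x
  ∈interval⁻ {a} {b} = ∈⟦⟧⁻ (λ x → a ≤? rank x ×-dec rank x ≤? b)

  -- A vertex outside an interval lies entirely below or entirely above it.
  interval-module : ∀ a b → IsModule T (interval a b)
  interval-module a b x y v x∈ y∈ v∉ with a ≤? rank v | rank v ≤? b
  ... | yes a≤v | yes v≤b = contradiction (∈interval⁺ (a≤v , v≤b)) v∉
  ... | no v≱a  | _       = trans (below (∈interval⁻ x∈)) (sym (below (∈interval⁻ y∈)))
    where
    below : ∀ {z} → InInterval a b z → arc T v z ≡ true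
    below (a≤z , _) = rank<⇒arc (<-≤-trans (≰⇒> v≱a) a≤z)
  ... | yes _   | no v≰b  = trans (above (∈interval⁻ x∈)) (sym (above (∈interval⁻ y∈)))
    where
    above : ∀ {z} → InInterval a b z → arc T v z ≡ false
    above (_ , z≤b) = rank>⇒¬arc (≤-<-trans z≤b (≰⇒> v≰b))

  interval-⊆ : ∀ {a b c d} → c ≤ a → b ≤ d → interval a b ⊆ interval c d
  interval-⊆ c≤a b≤d x∈ with ∈interval⁻ x∈
  ... | a≤x , x≤b = ∈interval⁺ (≤-trans c≤a a≤x , ≤-trans x≤b b≤d)

  intervals-disjoint : ∀ {a b c d} → b < c → Disjoint (interval a b) (interval c d)
  intervals-disjoint {a} {b} {c} {d} b<c = disjoint⁺ λ x∈ab x∈cd →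
    <-irrefl refl (<-≤-trans (≤-<-trans (proj₂ (∈interval⁻ {a} {b} x∈ab)) b<c) (proj₁ (∈interval⁻ {c} {d} x∈cd)))

  -- An interval [a, b] with a < b < n that is not all of [0, n-1] is a
  -- nontrivial module: it contains the vertices of ranks a and b and misses
  -- the vertex of rank 0 or of rank b + 1.
  interval-nontrivial : ∀ {a b} → a < b → b < n → 0 < a ⊎ suc b < n →
    IsNontrivialModule T (interval a b)
  interval-nontrivial {a} {b} a<b b<n proper with rank-surjective (<-trans a<b b<n) | rank-surjective b<n
  ... | u , ru≡a | w , rw≡b =
    interval-module a b , two-in-one-out⇒nontrivial u∈ w∈ u≢w (proj₂ (outsider proper))
    where
    u∈ : u ∈ interval a b
    u∈ = ∈interval⁺ (≤-reflexive (sym ru≡a) , ≤-trans (≤-reflexive ru≡a) (<⇒≤ a<b))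
    w∈ : w ∈ interval a b
    w∈ = ∈interval⁺ (≤-trans (<⇒≤ a<b) (≤-reflexive (sym rw≡b)) , ≤-reflexive rw≡b)
    u≢w : u ≢ w
    u≢w refl = <⇒≢ a<b (trans (sym ru≡a) rw≡b)
    outsider : 0 < a ⊎ suc b < n → ∃ λ o → o ∉ interval a b
    outsider (inj₁ 0<a) with o , ro≡0 ← rank-surjective (≤-<-trans z≤n b<n) =
      o , λ o∈ → <-irrefl refl (<-≤-trans 0<a (≤-trans (proj₁ (∈interval⁻ {a} {b} o∈)) (≤-reflexive ro≡0)))
    outsider (inj₂ b+1<n) with o , ro≡b+1 ← rank-surjective b+1<n =
      o , λ o∈ → <-irrefl refl (≤-trans (≤-reflexive (sym ro≡b+1)) (proj₂ (∈interval⁻ {a} {b} o∈)))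

complement-coModule : ∀ {n} (T : Tournament n) S → IsNontrivialModule T S → IsCoModule T (∁ S)
complement-coModule T S nontrivial =
  inj₂ (subst (IsNontrivialModule T) (sym (∁-involutive S)) nontrivial)

module LowerBound (m : ℕ) (T : Tournament (3 + m)) (transitive : IsTransitive T) where
  open Ranks T transitive

  -- Number of rank pairs {2j+1, 2j+2} fitting into the ranks 1 … m+1.
  K : ℕ
  K = ⌊ suc m /2⌋

  pair : ℕ → Subset (3 + m)
  pair j = interval (suc (j + j)) (suc (suc (j + j)))

  pair-top : ∀ {j} → j < K → suc (suc (j + j)) ≤ suc m
  pair-top {j} j<K = begin
    suc (suc (j + j)) ≡⟨ +-suc (suc j) j ⟨
    suc j + suc j     ≤⟨ +-mono-≤ j<K j<K ⟩
    K + K             ≤⟨ +-monoʳ-≤ K (⌊n/2⌋≤⌈n/2⌉ (suc m)) ⟩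
    K + ⌈ suc m /2⌉   ≡⟨ ⌊n/2⌋+⌈n/2⌉≡n (suc m) ⟩
    suc m             ∎
    where open ≤-Reasoning

  pair⊆ : ∀ {j} → j < K → pair j ⊆ interval 1 (suc m)
  pair⊆ j<K = interval-⊆ (s≤s z≤n) (pair-top j<K)

  pairs-disjoint : ∀ {i j} → i < j → Disjoint (pair i) (pair j)
  pairs-disjoint {i} {j} i<j = intervals-disjoint (s≤s (begin
    suc (suc (i + i)) ≡⟨ +-suc (suc i) i ⟨
    suc i + suc i     ≤⟨ +-mono-≤ i<j i<j ⟩
    j + j             ∎))
    where open ≤-Reasoning

  pair-nontrivial : ∀ {j} → j < K → IsNontrivialModule T (pair j)
  pair-nontrivial j<K =
    interval-nontrivial (n<1+n _) (s≤s (m≤n⇒m≤1+n (pair-top j<K))) (inj₁ (s≤s z≤n))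

  -- The source (rank 0) and the sink (rank m+2), as complements of intervals.
  source sink : Subset (3 + m)
  source = ∁ (interval 1 (suc (suc m)))
  sink   = ∁ (interval 0 (suc m))

  source-nontrivial : IsNontrivialModule T (interval 1 (suc (suc m)))
  source-nontrivial = interval-nontrivial (s≤s (s≤s z≤n)) ≤-refl (inj₁ (s≤s z≤n))

  sink-nontrivial : IsNontrivialModule T (interval 0 (suc m))
  sink-nontrivial = interval-nontrivial (s≤s z≤n) (n≤1+n _) (inj₂ ≤-refl)

  -- Every rank is in [1, m+2] or in [0, m+1].
  source-sink-disjoint : Disjoint source sink
  source-sink-disjoint = disjoint⁺ λ {x} x∈source x∈sink → case x x∈source x∈sink
    where
    case : ∀ x → x ∈ source → x ∉ sink
    case x x∈source x∈sink with rank x ≤? suc m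
    ... | yes x≤m+1 = x∈∁p⇒x∉p x∈sink (∈interval⁺ (z≤n , x≤m+1))
    ... | no x≰m+1  = x∈∁p⇒x∉p x∈source
      (∈interval⁺ (≤-trans (s≤s z≤n) (≰⇒> x≰m+1) , <⇒≤pred (rank<n x)))

  decomposition : List (Subset (3 + m))
  decomposition = source ∷ sink ∷ applyUpTo pair K

  decomposition-valid : IsCoModularDecomposition T decomposition
  decomposition-valid =
      ( complement-coModule T (interval 1 (suc (suc m))) source-nontrivial
      ∷ complement-coModule T (interval 0 (suc m)) sink-nontrivial
      ∷ All.applyUpTo⁺₁ pair K (λ j<K → inj₁ (pair-nontrivial j<K)) )
    , ( (source-sink-disjoint ∷ All.applyUpTo⁺₁ pair K
           (λ j<K → ∁-disjoint (⊆-trans (pair⊆ j<K) (interval-⊆ ≤-refl (n≤1+n _)))))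
      ∷ All.applyUpTo⁺₁ pair K (λ j<K → ∁-disjoint (⊆-trans (pair⊆ j<K) (interval-⊆ z≤n ≤-refl)))
      ∷ AllPairs.applyUpTo⁺₁ pair K (λ i<j _ → pairs-disjoint i<j) )

  decomposition-length : length decomposition ≡ ⌈ suc (3 + m) /2⌉
  decomposition-length = cong (suc ∘ suc) (length-applyUpTo pair K)

proposition2 : ∀ (n : ℕ) → n ≥ 3 → (T : Tournament n) → IsTransitive T →
    CoModularIndexIs T ⌈ suc n /2⌉
proposition2 (suc (suc (suc m))) (s≤s (s≤s (s≤s _))) T transitive =
  (decomposition , decomposition-valid , decomposition-length) , upper-bound
  where
  open LowerBound m T transitive
  open UpperBound T
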